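{- Let $M$ be a monoid and $A\subseteq M$ a recognizable subset. View $(M,A)$ as a structure in the signature $\{1,\cdot,P\}$ with $P$ interpreted as $A$, and let $\phi(x;u)$ be the formula $P(x\cdot u)$. Then $\phi$ is a stable formula in $\mathrm{Th}(M,A)$.
   Context: A subset $A$ of a monoid $M$ is recognizable if there exist a finite monoid $F$ and a monoid homomorphism $\alpha\colon M\to F$ with $A=\alpha^{ -1}(\alpha(A))$. -}

module Defs where

open import Level using (Level; _⊔_; suc)
open import Data.Nat using (ℕ)
open import Data.Fin using (Fin; _≤_)
open import Data.Product using (Σ; ∃; ∃-syntax; _×_; _,_)
open import Relation.Nullary using (¬_)
open import Relation.Unary using (Pred)
open import Function.Bundles using (_⇔_)
open import Algebra.Bundles using (Monoid)
open import Algebra.Morphism.Structures using (module MonoidMorphisms)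

IsFiniteMonoid : ∀ {c ℓ} → Monoid c ℓ → Set (c ⊔ ℓ)
IsFiniteMonoid F = Σ ℕ λ k → Σ (Fin k → Carrier) λ f → ∀ x → ∃[ i ] (f i ≈ x)
  where open Monoid F

IsMonoidHom : ∀ {c₁ ℓ₁ c₂ ℓ₂} (M : Monoid c₁ ℓ₁) (F : Monoid c₂ ℓ₂) →
              (Monoid.Carrier M → Monoid.Carrier F) → Set (c₁ ⊔ ℓ₁ ⊔ ℓ₂)
IsMonoidHom M F = MonoidMorphisms.IsMonoidHomomorphism (Monoid.rawMonoid M) (Monoid.rawMonoid F)

-- A ⊆ M is recognizable: there are a finite monoid F and a homomorphism
-- α : M → F with A = α⁻¹(α(A)), i.e. x ∈ A ⇔ ∃ y ∈ A, α x ≈ α y.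
Recognizable : ∀ {c ℓ a} (M : Monoid c ℓ) → Pred (Monoid.Carrier M) a →
               (c' ℓ' : Level) → Set (c ⊔ ℓ ⊔ a ⊔ suc (c' ⊔ ℓ'))
Recognizable M A c' ℓ' =
  Σ (Monoid c' ℓ') λ F → IsFiniteMonoid F ×
  Σ (Monoid.Carrier M → Monoid.Carrier F) λ α → IsMonoidHom M F α ×
  (∀ x → A x ⇔ (∃[ y ] (A y × Monoid._≈_ F (α x) (α y))))

-- The formula φ(x;u) := P(x · u) in the structure (M, 1, ·, P) with P = A.
-- φ has a half-graph (ladder) of length n in (M,A): a₀..aₙ₋₁, b₀..bₙ₋₁ with
-- φ(aᵢ; bⱼ) ⇔ i ≤ j.
HalfGraph : ∀ {c ℓ a} (M : Monoid c ℓ) → Pred (Monoid.Carrier M) a → ℕ → Set (c ⊔ a)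
HalfGraph M A n =
  Σ (Fin n → Carrier) λ as → Σ (Fin n → Carrier) λ bs →
    ∀ i j → A (as i ∙ bs j) ⇔ (i ≤ j)
  where open Monoid M

-- φ(x;u) = P(x·u) is stable in Th(M,A): it does not have the order property,
-- i.e. there is a finite bound on the length of half-graphs in (M,A).
-- (Having a half-graph of length n is a first-order sentence, so this is
-- exactly stability of φ in the complete theory Th(M,A).)
StableMulFormula : ∀ {c ℓ a} (M : Monoid c ℓ) → Pred (Monoid.Carrier M) a → Set (c ⊔ a)
StableMulFormula M A = Σ ℕ λ n → ¬ HalfGraph M A n

-- A recognizing homomorphism α : M → F into a finite monoid with k elements
-- has, among any k + 1 rows a₀, …, aₖ of a half-graph, two rows aᵢ, aⱼ (i < j)
-- with α aᵢ ≈ α aⱼ.  Since A is a union of fibres of α and α is multiplicative,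
-- aᵢ · u ∈ A iff aⱼ · u ∈ A for every u; taking u = bᵢ gives j ≤ i, a
-- contradiction.
module Submission where

open import Defs
open import Relation.Unary using (Pred)
open import Relation.Binary.Bundles using (Setoid)
open import Relation.Binary.PropositionalEquality using (cong)
open import Algebra.Bundles using (Monoid)
open import Data.Nat using (suc)
open import Data.Nat.Properties using (n<1+n; <⇒≱)
open import Data.Fin using (Fin; _≤_; _<_)
open import Data.Fin.Properties using (pigeonhole; ≤-refl)
open import Data.Product using (∃; ∃₂; _×_; _,_; proj₁; proj₂)
open import Relation.Nullary using (¬_)
open import Function.Bundles using (_⇔_; Equivalence)
open import Algebra.Morphism.Structures using (module MonoidMorphisms)

module _ {c ℓ} (S : Setoid c ℓ) where
  open Setoid S

  pigeonhole-≈ : ∀ {k} (enum : Fin k → Carrier) → (∀ x → ∃ λ i → enum i ≈ x) →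
                 (g : Fin (suc k) → Carrier) → ∃₂ λ i j → i < j × g i ≈ g j
  pigeonhole-≈ {k} enum covers g
    with i , j , i<j , same-index ← pigeonhole (n<1+n k) (λ i → proj₁ (covers (g i)))
    = i , j , i<j , (begin
        g i                           ≈⟨ sym (proj₂ (covers (g i))) ⟩
        enum (proj₁ (covers (g i)))   ≡⟨ cong enum same-index ⟩
        enum (proj₁ (covers (g j)))   ≈⟨ proj₂ (covers (g j)) ⟩
        g j                           ∎)
    where open import Relation.Binary.Reasoning.Setoid S

module _ {c ℓ a c' ℓ'} (M : Monoid c ℓ) (F : Monoid c' ℓ')
         {α : Monoid.Carrier M → Monoid.Carrier F} (hom : IsMonoidHom M F α)
         {A : Pred (Monoid.Carrier M) a}
         (saturated : ∀ x → A x ⇔ ∃ λ y → A y × Monoid._≈_ F (α x) (α y)) where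
  private
    module M = Monoid M
    module F = Monoid F
  open MonoidMorphisms.IsMonoidHomomorphism hom using (homo)

  saturated-respects : ∀ {x x'} → α x F.≈ α x' → A x → A x'
  saturated-respects αx≈αx' Ax
    with y , Ay , αx≈αy ← Equivalence.to (saturated _) Ax
    = Equivalence.from (saturated _) (y , Ay , F.trans (F.sym αx≈αx') αx≈αy)

  homo-congʳ : ∀ {x x'} u → α x F.≈ α x' → α (x M.∙ u) F.≈ α (x' M.∙ u)
  homo-congʳ {x} {x'} u αx≈αx' = begin
    α (x M.∙ u)     ≈⟨ homo x u ⟩
    α x F.∙ α u     ≈⟨ F.∙-congʳ αx≈αx' ⟩
    α x' F.∙ α u    ≈⟨ F.sym (homo x' u) ⟩
    α (x' M.∙ u)    ∎
    where open import Relation.Binary.Reasoning.Setoid F.setoid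

  halfGraph-rows-separated : ∀ {n} (as bs : Fin n → M.Carrier) →
                             (∀ i j → A (as i M.∙ bs j) ⇔ i ≤ j) →
                             ∀ {i j} → i < j → ¬ α (as i) F.≈ α (as j)
  halfGraph-rows-separated as bs ladder {i} {j} i<j αaᵢ≈αaⱼ = <⇒≱ i<j j≤i
    where
    Aaᵢbᵢ : A (as i M.∙ bs i)
    Aaᵢbᵢ = Equivalence.from (ladder i i) ≤-refl

    j≤i : j ≤ i
    j≤i = Equivalence.to (ladder j i)
            (saturated-respects (homo-congʳ (bs i) αaᵢ≈αaⱼ) Aaᵢbᵢ)

corollary2p5 : ∀ {c ℓ a c' ℓ'} (M : Monoid c ℓ) (A : Pred (Monoid.Carrier M) a) →
                 Recognizable M A c' ℓ' → StableMulFormula M A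
corollary2p5 M A (F , (k , enum , covers) , α , hom , saturated) = suc k , no-halfGraph
  where
  no-halfGraph : ¬ HalfGraph M A (suc k)
  no-halfGraph (as , bs , ladder)
    with i , j , i<j , αaᵢ≈αaⱼ ← pigeonhole-≈ (Monoid.setoid F) enum covers (λ i → α (as i))
    = halfGraph-rows-separated M F hom saturated as bs ladder i<j αaᵢ≈αaⱼ
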